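{- Let $\ell$ be a nonnegative integer. In a token game with $m$ tokens and at most $2^\ell$ transfer steps, each column gains a net of at most $1+2\ell\lceil\sqrt{2m}\rceil$ tokens; that is, if a column contains $a$ tokens in the first array of the transcript and $b$ tokens in the last array, then $b-a\le 1+2\ell\lceil\sqrt{2m}\rceil$.
   Context: Token game: played on an array $B$ with rows indexed by the positive integers and columns indexed by a finite list; each cell $B(i,u)$ is empty or contains a token. A token in $B(i,u)$ is grounded if all cells of column $u$ below it (rows $1,\ldots,i-1$) contain tokens; otherwise it is ungrounded. One column is the active column. A step, with active column $u$: if column $u$ contains grounded tokens, the player may optionally move the highest grounded token of column $u$ from its cell $B(i,u)$ to an empty cell $B(i',v)$ with $i'\le i$, provided no prior step of the game moved a token between columns $u$ and $v$; then all ungrounded tokens in column $u$ shift down by one cell, and the active column advances cyclically through the list. A step in which a token moves between columns is a transfer step. The transcript of a token game is the list of arrays it produces. -}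

module Defs where

open import Data.Nat using (ℕ; zero; suc; _+_; _*_; _≤_; _<_; _%_)
open import Data.Nat.DivMod using (m%n<n)
open import Data.Bool using (Bool; true; false; _∧_; _∨_; not; if_then_else_)
open import Data.Fin using (Fin; toℕ; fromℕ<; _≟_)
open import Data.Product using (Σ; _×_; _,_)
open import Data.List using (List; []; _∷_; length)
open import Data.List.Membership.Propositional using (_∈_)
open import Data.List.Relation.Unary.Unique.Propositional using (Unique)
open import Relation.Binary.PropositionalEquality using (_≡_)
open import Relation.Nullary using (¬_)
open import Relation.Nullary.Decidable using (⌊_⌋)

-- Rows are indexed by ℕ, where index r stands for the paper's row r+1.
-- B u r ≡ true  means cell (row r+1, column u) contains a token.
Array : ℕ → Set
Array k = Fin k → ℕ → Bool

groundedᵇ : (ℕ → Bool) → ℕ → Bool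
groundedᵇ c zero    = true
groundedᵇ c (suc r) = groundedᵇ c r ∧ c r

HighestGrounded : ∀ {k} → Array k → Fin k → ℕ → Set
HighestGrounded B u i =
  (B u i ≡ true) × (groundedᵇ (B u) i ≡ true) ×
  (∀ j → i < j → B u j ≡ true → groundedᵇ (B u) j ≡ false)

-- All ungrounded tokens of a column shift down by one cell
-- (grounded tokens stay; the cell at index j receives the token from j+1
-- if that token is ungrounded).
shiftCol : (ℕ → Bool) → ℕ → Bool
shiftCol c j = (c j ∧ groundedᵇ c j) ∨ (c (suc j) ∧ not (groundedᵇ c (suc j)))

shift : ∀ {k} → Array k → Fin k → Array k
shift B u v j = if ⌊ v ≟ u ⌋ then shiftCol (B u) j else B v j

moveTok : ∀ {k} → Array k → Fin k → ℕ → Fin k → ℕ → Array k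
moveTok B u i v i' w j =
  if ⌊ w ≟ v ⌋ ∧ ⌊ j Data.Nat.≟ i' ⌋ then true
  else if ⌊ w ≟ u ⌋ ∧ ⌊ j Data.Nat.≟ i ⌋ then false
  else B w j

next : ∀ {n} → Fin (suc n) → Fin (suc n)
next {n} u = fromℕ< (m%n<n (suc (toℕ u)) (suc n))

-- Game state: array, active column, and the list of (source,target) column
-- pairs of all moves made so far.
record State (k : ℕ) : Set where
  constructor st
  field
    arr    : Array k
    active : Fin k
    hist   : List (Fin k × Fin k)
open State public

-- One step of the game; the Bool records whether it is a transfer step
-- (a token moved between two (distinct) columns).
data Step {n : ℕ} : State (suc n) → State (suc n) → Bool → Set where
  noMove : ∀ B u h → Step (st B u h) (st (shift B u) (next u) h) false
  move   : ∀ B u h i v i' →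
           HighestGrounded B u i →
           B v i' ≡ false →
           i' ≤ i →
           ¬ ((u , v) ∈ h) → ¬ ((v , u) ∈ h) →
           Step (st B u h)
                (st (shift (moveTok B u i v i') u) (next u) ((u , v) ∷ h))
                (not ⌊ u ≟ v ⌋)

-- A (finite) play of the game from one state to another, with the number
-- of transfer steps.  Its transcript is the list of arrays of the visited
-- states; the first array is that of the source, the last that of the target.
data Run {n : ℕ} : State (suc n) → State (suc n) → ℕ → Set where
  done : ∀ s → Run s s 0
  step : ∀ {s s' s'' b t} → Step s s' b → Run s' s'' t →
         Run s s'' (if b then suc t else t)

ColCount : ∀ {k} → Array k → Fin k → ℕ → Set
ColCount B u a = Σ (List ℕ) λ rs →
  (length rs ≡ a) × Unique rs × (∀ i → (B u i ≡ true → i ∈ rs) × (i ∈ rs → B u i ≡ true))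

TokenCount : ∀ {k} → Array k → ℕ → Set
TokenCount {k} B m = Σ (List (Fin k × ℕ)) λ cs →
  (length cs ≡ m) × Unique cs ×
  (∀ u i → (B u i ≡ true → (u , i) ∈ cs) × ((u , i) ∈ cs → B u i ≡ true))

IsCeilSqrt : ℕ → ℕ → Set
IsCeilSqrt x s = (x ≤ s * s) × (∀ t → x ≤ t * t → s ≤ t)

module Submission where

-- Induction on ℓ.  A transfer step raises a column by at most one token, which
-- settles ℓ = 0.  For the doubling step cut the run into two halves with at most
-- 2^ℓ transfer steps each and let k = c + 2ℓc.  Below height k a column holds at
-- most k tokens.  A token arrives at height ≥ k in the observed column v only by
-- a transfer of the highest grounded token of some column u from height ≥ k, so u
-- then holds more than k tokens, and by the induction hypothesis it held at least
-- c tokens at the start of the half.  Since every pair (u , v) transfers at most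
-- once, each half raises v at height ≥ k by at most the number of columns with at
-- least c tokens, which is at most m / c; both halves together add at most
-- 2m / c ≤ c.

open import Data.Bool using (Bool; true; false; _∧_; _∨_; not; if_then_else_)
open import Data.Bool.Properties using (∧-zeroʳ; ∧-conicalˡ; ∧-conicalʳ; ¬-not)
open import Data.Fin using (Fin) renaming (zero to fzero; suc to fsuc)
import Data.Fin as Fin
open import Data.Fin.Properties using () renaming (suc-injective to fsuc-injective)
open import Data.List using (List; []; _∷_; length; map)
import Data.List.Extrema.Nat as Extrema
open import Data.List.Membership.Propositional using (_∈_; _∉_)
open import Data.List.Membership.Propositional.Properties using (∈-map⁺)
open import Data.List.Properties using (length-map)
open import Data.List.Relation.Unary.All using () renaming (lookup to All-lookup)
open import Data.List.Relation.Unary.AllPairs using (_∷_)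
open import Data.List.Relation.Unary.Any using (here; there)
open import Data.List.Relation.Unary.Unique.Propositional using (Unique)
open import Data.Product using (_×_; _,_; proj₁; proj₂)
open import Data.Product.Properties using (≡-dec)
open import Data.Nat using (ℕ; zero; suc; _+_; _*_; _^_; _≤_; _<_; _⊓_; _≟_; _≤?_; z≤n; s≤s; s≤s⁻¹; NonZero)
open import Data.Nat.Tactic.RingSolver using (solve-∀)
open import Data.Nat.Properties
open import Algebra.Properties.CommutativeSemigroup +-commutativeSemigroup using (x∙yz≈y∙xz)
open import Data.Sum using (inj₁; inj₂)
open import Function using (_∘_)
open import Relation.Binary.PropositionalEquality
open import Relation.Nullary using (Dec; ¬_; yes; no; contradiction)
open import Relation.Nullary.Decidable using (⌊_⌋; isYes≗does; dec-true; dec-false)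
open import Defs

indicator : Bool → ℕ
indicator true  = 1
indicator false = 0

indicator≤1 : ∀ b → indicator b ≤ 1
indicator≤1 true  = ≤-refl
indicator≤1 false = z≤n

indicator-mono : ∀ {a b} → (a ≡ true → b ≡ true) → indicator a ≤ indicator b
indicator-mono {false} _   = z≤n
indicator-mono {true}  a⇒b rewrite a⇒b refl = ≤-refl

⌊⌋-yes : ∀ {A : Set} (d : Dec A) → A → ⌊ d ⌋ ≡ true
⌊⌋-yes d a = trans (isYes≗does d) (dec-true d a)

⌊⌋-no : ∀ {A : Set} (d : Dec A) → ¬ A → ⌊ d ⌋ ≡ false
⌊⌋-no d ¬a = trans (isYes≗does d) (dec-false d ¬a)

⌊⌋-true : ∀ {A : Set} (d : Dec A) → ⌊ d ⌋ ≡ true → A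
⌊⌋-true (yes a) _ = a

⌊⌋-false : ∀ {A : Set} (d : Dec A) → ⌊ d ⌋ ≡ false → ¬ A
⌊⌋-false (no ¬a) _ = ¬a

Column : Set
Column = ℕ → Bool

_⊆ᵇ_ : Column → Column → Set
f ⊆ᵇ g = ∀ j → f j ≡ true → g j ≡ true

count : Column → ℕ → ℕ
count f zero    = 0
count f (suc N) = indicator (f N) + count f N

count-cong : ∀ {f g} N → (∀ j → j < N → f j ≡ g j) → count f N ≡ count g N
count-cong zero    _   = refl
count-cong (suc N) f≗g =
  cong₂ _+_ (cong indicator (f≗g N ≤-refl)) (count-cong N (λ j j<N → f≗g j (m<n⇒m<1+n j<N)))

count-mono : ∀ {f g} → f ⊆ᵇ g → ∀ N → count f N ≤ count g N
count-mono f⊆g zero    = z≤n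
count-mono f⊆g (suc N) = +-mono-≤ (indicator-mono (f⊆g N)) (count-mono f⊆g N)

count≤bound : ∀ f N → count f N ≤ N
count≤bound f zero    = z≤n
count≤bound f (suc N) = +-mono-≤ (indicator≤1 (f N)) (count≤bound f N)

count-monoᴺ : ∀ f {M N} → M ≤ N → count f M ≤ count f N
count-monoᴺ f {N = zero}  z≤n   = z≤n
count-monoᴺ f {N = suc N} M≤1+N with m≤n⇒m<n∨m≡n M≤1+N
... | inj₁ M<1+N = ≤-trans (count-monoᴺ f (s≤s⁻¹ M<1+N)) (m≤n+m _ _)
... | inj₂ refl  = ≤-refl

count-nothing : ∀ N → count (λ _ → false) N ≡ 0
count-nothing zero    = refl
count-nothing (suc N) = count-nothing N

count-full : ∀ f N → (∀ j → j < N → f j ≡ true) → count f N ≡ N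
count-full f zero    _    = refl
count-full f (suc N) full rewrite full N ≤-refl =
  cong suc (count-full f N (λ j j<N → full j (m<n⇒m<1+n j<N)))

removeAt : ℕ → Column → Column
removeAt p g j = if ⌊ j ≟ p ⌋ then false else g j

insertAt : ℕ → Column → Column
insertAt p g j = if ⌊ j ≟ p ⌋ then true else g j

removeAt-here : ∀ p g → removeAt p g p ≡ false
removeAt-here p g = cong (λ b → if b then false else g p) (⌊⌋-yes (p ≟ p) refl)

removeAt-there : ∀ {p j} g → j ≢ p → removeAt p g j ≡ g j
removeAt-there {p} {j} g j≢p = cong (λ b → if b then false else g j) (⌊⌋-no (j ≟ p) j≢p)

insertAt-there : ∀ {p j} g → j ≢ p → insertAt p g j ≡ g j
insertAt-there {p} {j} g j≢p = cong (λ b → if b then true else g j) (⌊⌋-no (j ≟ p) j≢p)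

removeAt-⊆ : ∀ p g → removeAt p g ⊆ᵇ g
removeAt-⊆ p g j with j ≟ p
... | yes _ = λ ()
... | no _  = λ gj → gj

count-removeAt : ∀ f {p} N → f p ≡ true → p < N → suc (count (removeAt p f) N) ≡ count f N
count-removeAt f {p} (suc N) fp p<1+N with p ≟ N
... | yes refl = begin
  suc (indicator (removeAt N f N) + count (removeAt N f) N)
    ≡⟨ cong₂ (λ a b → suc (indicator a + b)) (removeAt-here N f) below-N ⟩
  suc (count f N)
    ≡⟨ cong (_+ count f N) (cong indicator (sym fp)) ⟩
  indicator (f N) + count f N ∎
  where
  open ≡-Reasoning
  below-N : count (removeAt N f) N ≡ count f N
  below-N = count-cong N (λ j j<N → removeAt-there f (<⇒≢ j<N))
... | no p≢N = begin
  suc (indicator (removeAt p f N) + count (removeAt p f) N)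
    ≡⟨ cong (λ a → suc (indicator a + count (removeAt p f) N)) (removeAt-there f (p≢N ∘ sym)) ⟩
  suc (indicator (f N) + count (removeAt p f) N)
    ≡⟨ sym (+-suc _ _) ⟩
  indicator (f N) + suc (count (removeAt p f) N)
    ≡⟨ cong (indicator (f N) +_) (count-removeAt f N fp p<N) ⟩
  indicator (f N) + count f N ∎
  where
  open ≡-Reasoning
  p<N : p < N
  p<N = ≤∧≢⇒< (s≤s⁻¹ p<1+N) p≢N

count≤removeAt : ∀ f p N → count f N ≤ suc (count (removeAt p f) N)
count≤removeAt f p zero = z≤n
count≤removeAt f p (suc N) with p ≟ N
... | yes refl = begin
  indicator (f N) + count f N                              ≤⟨ +-monoˡ-≤ _ (indicator≤1 (f N)) ⟩
  suc (count f N)                                          ≡⟨ cong suc below-N ⟩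
  suc (count (removeAt N f) N)                             ≡⟨ cong (λ a → suc (indicator a + count (removeAt N f) N)) (sym (removeAt-here N f)) ⟩
  suc (indicator (removeAt N f N) + count (removeAt N f) N) ∎
  where
  open ≤-Reasoning
  below-N : count f N ≡ count (removeAt N f) N
  below-N = count-cong N (λ j j<N → sym (removeAt-there f (<⇒≢ j<N)))
... | no p≢N = begin
  indicator (f N) + count f N                            ≤⟨ +-monoʳ-≤ _ (count≤removeAt f p N) ⟩
  indicator (f N) + suc (count (removeAt p f) N)         ≡⟨ +-suc _ _ ⟩
  suc (indicator (f N) + count (removeAt p f) N)         ≡⟨ cong (λ a → suc (indicator a + count (removeAt p f) N)) (sym (removeAt-there f (p≢N ∘ sym))) ⟩
  suc (indicator (removeAt p f N) + count (removeAt p f) N) ∎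
  where open ≤-Reasoning

count-oneMore : ∀ {f g} p → (∀ j → j ≢ p → f j ≡ true → g j ≡ true) → ∀ N → count f N ≤ suc (count g N)
count-oneMore {f} {g} p f⊆g+p N =
  ≤-trans (count≤removeAt f p N) (s≤s (count-mono removed⊆g N))
  where
  removed⊆g : removeAt p f ⊆ᵇ g
  removed⊆g j with j ≟ p
  ... | yes _    = λ ()
  ... | no j≢p   = f⊆g+p j j≢p

count-insertAt : ∀ p g N → count (insertAt p g) N ≤ suc (count g N)
count-insertAt p g = count-oneMore p (λ j j≢p → trans (sym (insertAt-there g j≢p)))

-- Shifting the ungrounded tokens of c down by one cell changes the number of
-- tokens below N only by the token that descends from row N into the prefix.
count-shiftCol : ∀ c N → count (shiftCol c) N ≡ indicator (c N ∧ not (groundedᵇ c N)) + count c N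
count-shiftCol c zero = cong (λ b → indicator b + 0) (sym (∧-zeroʳ (c 0)))
count-shiftCol c (suc N) = begin
  indicator (shiftCol c N) + count (shiftCol c) N
    ≡⟨ cong (indicator (shiftCol c N) +_) (count-shiftCol c N) ⟩
  indicator (shiftCol c N) + (indicator (c N ∧ not (groundedᵇ c N)) + count c N)
    ≡⟨ sym (+-assoc (indicator (shiftCol c N)) (indicator (c N ∧ not (groundedᵇ c N))) (count c N)) ⟩
  indicator (shiftCol c N) + indicator (c N ∧ not (groundedᵇ c N)) + count c N
    ≡⟨ cong (_+ count c N) (descent (c N) (groundedᵇ c N) (c (suc N))) ⟩
  indicator (c (suc N) ∧ not (groundedᵇ c (suc N))) + indicator (c N) + count c N
    ≡⟨ +-assoc (indicator (c (suc N) ∧ not (groundedᵇ c (suc N)))) (indicator (c N)) (count c N) ⟩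
  indicator (c (suc N) ∧ not (groundedᵇ c (suc N))) + count c (suc N) ∎
  where
  open ≡-Reasoning
  descent : ∀ a g a' → indicator ((a ∧ g) ∨ (a' ∧ not (g ∧ a))) + indicator (a ∧ not g)
                       ≡ indicator (a' ∧ not (g ∧ a)) + indicator a
  descent true  true  true  = refl
  descent true  true  false = refl
  descent true  false true  = refl
  descent true  false false = refl
  descent false true  true  = refl
  descent false true  false = refl
  descent false false true  = refl
  descent false false false = refl

-- Tokens only move down, so every prefix gains tokens ...
count≤count-shiftCol : ∀ c N → count c N ≤ count (shiftCol c) N
count≤count-shiftCol c N = ≤-trans (m≤n+m (count c N) _) (≤-reflexive (sym (count-shiftCol c N)))

count-shiftCol-closed : ∀ c N → c N ≡ false → count (shiftCol c) N ≡ count c N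
count-shiftCol-closed c N cN rewrite count-shiftCol c N | cN = refl

above : ℕ → Column → Column
above k f j = ⌊ k ≤? j ⌋ ∧ f j

countFrom : ℕ → Column → ℕ → ℕ
countFrom k f N = count (above k f) N

count-split : ∀ k f N → count f N ≡ count f (k ⊓ N) + countFrom k f N
count-split k f zero = sym (trans (+-identityʳ _) (cong (count f) (⊓-zeroʳ k)))
count-split k f (suc N) with k ≤? N
... | yes k≤N = begin
  indicator (f N) + count f N
    ≡⟨ cong (indicator (f N) +_) (count-split k f N) ⟩
  indicator (f N) + (count f (k ⊓ N) + countFrom k f N)
    ≡⟨ x∙yz≈y∙xz (indicator (f N)) (count f (k ⊓ N)) (countFrom k f N) ⟩
  count f (k ⊓ N) + (indicator (f N) + countFrom k f N)
    ≡⟨ cong (λ x → count f x + (indicator (f N) + countFrom k f N)) (trans (m≤n⇒m⊓n≡m k≤N) (sym (m≤n⇒m⊓n≡m (m≤n⇒m≤1+n k≤N)))) ⟩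
  count f (k ⊓ suc N) + (indicator (f N) + countFrom k f N) ∎
  where open ≡-Reasoning
... | no k≰N = begin
  indicator (f N) + count f N
    ≡⟨ cong (indicator (f N) +_) (count-split k f N) ⟩
  indicator (f N) + (count f (k ⊓ N) + countFrom k f N)
    ≡⟨ cong (λ x → indicator (f N) + (count f x + countFrom k f N)) (m≥n⇒m⊓n≡n (<⇒≤ N<k)) ⟩
  indicator (f N) + (count f N + countFrom k f N)
    ≡⟨ sym (+-assoc (indicator (f N)) (count f N) (countFrom k f N)) ⟩
  count f (suc N) + countFrom k f N
    ≡⟨ cong (λ x → count f x + countFrom k f N) (sym (m≥n⇒m⊓n≡n N<k)) ⟩
  count f (k ⊓ suc N) + countFrom k f N ∎
  where
  open ≡-Reasoning
  N<k : N < k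
  N<k = ≰⇒> k≰N

-- At most k positions lie below height k.
count≤threshold+countFrom : ∀ k f N → count f N ≤ k + countFrom k f N
count≤threshold+countFrom k f N = begin
  count f N                          ≡⟨ count-split k f N ⟩
  count f (k ⊓ N) + countFrom k f N  ≤⟨ +-monoˡ-≤ _ (≤-trans (count≤bound f (k ⊓ N)) (m⊓n≤m k N)) ⟩
  k + countFrom k f N                ∎
  where open ≤-Reasoning

countFrom≤count : ∀ k f N → countFrom k f N ≤ count f N
countFrom≤count k f = count-mono (λ j → ∧-conicalʳ ⌊ k ≤? j ⌋ (f j))

countFrom-mono : ∀ k {f g} → f ⊆ᵇ g → ∀ N → countFrom k f N ≤ countFrom k g N
countFrom-mono k {f} {g} f⊆g = count-mono above-mono
  where
  above-mono : ∀ j → above k f j ≡ true → above k g j ≡ true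
  above-mono j with k ≤? j
  ... | yes _ = f⊆g j
  ... | no _  = λ ()

countFrom-cong : ∀ k {f g} N → f ≗ g → countFrom k f N ≡ countFrom k g N
countFrom-cong k N f≗g = count-cong N (λ j _ → cong (⌊ k ≤? j ⌋ ∧_) (f≗g j))

-- Since shifting only moves tokens down, no height window gains tokens.
countFrom-shiftCol : ∀ k c N → c N ≡ false → countFrom k (shiftCol c) N ≤ countFrom k c N
countFrom-shiftCol k c N cN = +-cancelˡ-≤ (count c (k ⊓ N)) _ _ (begin
  count c (k ⊓ N) + countFrom k (shiftCol c) N
    ≤⟨ +-monoˡ-≤ _ (count≤count-shiftCol c (k ⊓ N)) ⟩
  count (shiftCol c) (k ⊓ N) + countFrom k (shiftCol c) N
    ≡⟨ sym (count-split k (shiftCol c) N) ⟩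
  count (shiftCol c) N
    ≡⟨ count-shiftCol-closed c N cN ⟩
  count c N
    ≡⟨ count-split k c N ⟩
  count c (k ⊓ N) + countFrom k c N ∎)
  where open ≤-Reasoning

countFrom-insertAt : ∀ k p g N → countFrom k (insertAt p g) N ≤ suc (countFrom k g N)
countFrom-insertAt k p g = count-oneMore p above-insert
  where
  above-insert : ∀ j → j ≢ p → above k (insertAt p g) j ≡ true → above k g j ≡ true
  above-insert j j≢p with k ≤? j
  ... | yes _ = trans (sym (insertAt-there g j≢p))
  ... | no _  = λ ()

countFrom-insertAt-below : ∀ k {p} g N → p < k → countFrom k (insertAt p g) N ≤ countFrom k g N
countFrom-insertAt-below k {p} g N p<k = count-mono above-insert N
  where
  above-insert : ∀ j → above k (insertAt p g) j ≡ true → above k g j ≡ true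
  above-insert j with k ≤? j
  ... | yes k≤j = trans (sym (insertAt-there g (λ { refl → <⇒≱ p<k k≤j })))
  ... | no _    = λ ()

grounded⇒full : ∀ c i → groundedᵇ c i ≡ true → ∀ j → j < i → c j ≡ true
grounded⇒full c (suc i) grounded j j<1+i with m≤n⇒m<n∨m≡n (s≤s⁻¹ j<1+i)
... | inj₁ j<i  = grounded⇒full c i (∧-conicalˡ (groundedᵇ c i) (c i) grounded) j j<i
... | inj₂ refl = ∧-conicalʳ (groundedᵇ c i) (c i) grounded

highestGrounded⇒full : ∀ {k} {B : Array k} {u i} → HighestGrounded B u i → ∀ j → j ≤ i → B u j ≡ true
highestGrounded⇒full {B = B} {u} (Bui , grounded , _) j j≤i with m≤n⇒m<n∨m≡n j≤i
... | inj₁ j<i  = grounded⇒full (B u) _ grounded j j<i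
... | inj₂ refl = Bui

highestGrounded-count : ∀ {k} {B : Array k} {u i} → HighestGrounded B u i → ∀ {N} → i < N → suc i ≤ count (B u) N
highestGrounded-count {B = B} {u} {i} hg {N} i<N = begin
  suc i               ≡⟨ sym (count-full (B u) (suc i) (λ j j≤i → highestGrounded⇒full {B = B} hg j (s≤s⁻¹ j≤i))) ⟩
  count (B u) (suc i) ≤⟨ count-monoᴺ (B u) i<N ⟩
  count (B u) N       ∎
  where open ≤-Reasoning

EmptyFrom : ℕ → Column → Set
EmptyFrom R c = ∀ j → R ≤ j → c j ≡ false

emptyFrom-intro : ∀ {R c} → (∀ j → c j ≡ true → j < R) → EmptyFrom R c
emptyFrom-intro below j R≤j = ¬-not (λ cj → <⇒≱ (below j cj) R≤j)

emptyFrom⇒< : ∀ {R c j} → EmptyFrom R c → c j ≡ true → j < R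
emptyFrom⇒< {j = j} empty cj = ≰⇒> (λ R≤j → contradiction (trans (sym cj) (empty j R≤j)) λ ())

emptyFrom-⊆ : ∀ {R f g} → f ⊆ᵇ g → EmptyFrom R g → EmptyFrom R f
emptyFrom-⊆ f⊆g empty = emptyFrom-intro (λ j fj → emptyFrom⇒< empty (f⊆g j fj))

shiftCol-emptyFrom : ∀ {R c} → EmptyFrom R c → EmptyFrom R (shiftCol c)
shiftCol-emptyFrom {c = c} empty j R≤j
  rewrite empty j R≤j | empty (suc j) (m≤n⇒m≤1+n R≤j) = refl

insertAt-emptyFrom : ∀ {R p g} → p < R → EmptyFrom R g → EmptyFrom R (insertAt p g)
insertAt-emptyFrom {g = g} p<R empty j R≤j =
  trans (insertAt-there g (λ { refl → <⇒≱ p<R R≤j })) (empty j R≤j)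

sumFin : ∀ {n} → (Fin n → ℕ) → ℕ
sumFin {zero}  f = 0
sumFin {suc n} f = f fzero + sumFin (f ∘ fsuc)

sumFin-zero : ∀ n → sumFin {n} (λ _ → 0) ≡ 0
sumFin-zero zero    = refl
sumFin-zero (suc n) = sumFin-zero n

sumFin-mono : ∀ {n} {f g : Fin n → ℕ} → (∀ w → f w ≤ g w) → sumFin f ≤ sumFin g
sumFin-mono {zero}  f≤g = z≤n
sumFin-mono {suc n} f≤g = +-mono-≤ (f≤g fzero) (sumFin-mono (f≤g ∘ fsuc))

sumFin-term : ∀ {n} (f : Fin n → ℕ) u → f u ≤ sumFin f
sumFin-term f fzero    = m≤m+n _ _
sumFin-term f (fsuc u) = ≤-trans (sumFin-term (f ∘ fsuc) u) (m≤n+m _ _)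

sumFin-*ʳ : ∀ {n} (f : Fin n → ℕ) c → sumFin (λ w → f w * c) ≡ sumFin f * c
sumFin-*ʳ {zero}  f c = refl
sumFin-*ʳ {suc n} f c = trans (cong (f fzero * c +_) (sumFin-*ʳ (f ∘ fsuc) c))
                              (sym (*-distribʳ-+ c (f fzero) _))

sumFin-oneMore : ∀ {n} {f g : Fin n → ℕ} u → (∀ w → w ≢ u → f w ≤ g w) → f u ≤ suc (g u) →
                 sumFin f ≤ suc (sumFin g)
sumFin-oneMore {suc n} fzero f≤g fu≤ = +-mono-≤ fu≤ (sumFin-mono (λ w → f≤g (fsuc w) λ ()))
sumFin-oneMore {suc n} {f} {g} (fsuc u) f≤g fu≤ = begin
  f fzero + sumFin (f ∘ fsuc)       ≤⟨ +-mono-≤ (f≤g fzero λ ()) (sumFin-oneMore u (λ w w≢u → f≤g (fsuc w) (w≢u ∘ fsuc-injective)) fu≤) ⟩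
  g fzero + suc (sumFin (g ∘ fsuc)) ≡⟨ +-suc _ _ ⟩
  suc (sumFin g)                    ∎
  where open ≤-Reasoning

sumFin-strict : ∀ {n} {f g : Fin n → ℕ} u → (∀ w → f w ≤ g w) → f u < g u → suc (sumFin f) ≤ sumFin g
sumFin-strict {suc n} fzero    f≤g fu<gu = +-mono-≤ fu<gu (sumFin-mono (f≤g ∘ fsuc))
sumFin-strict {suc n} {f} {g} (fsuc u) f≤g fu<gu = begin
  suc (f fzero + sumFin (f ∘ fsuc)) ≡⟨ sym (+-suc _ _) ⟩
  f fzero + suc (sumFin (f ∘ fsuc)) ≤⟨ +-mono-≤ (f≤g fzero) (sumFin-strict u (f≤g ∘ fsuc) fu<gu) ⟩
  sumFin g                          ∎
  where open ≤-Reasoning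

sumFin-exchange : ∀ {n} {f g : Fin n → ℕ} {u v} → u ≢ v → f u < g u → f v ≤ suc (g v) →
                  (∀ w → w ≢ u → w ≢ v → f w ≤ g w) → sumFin f ≤ sumFin g
sumFin-exchange {f = f} {g} {u} {v} u≢v fu<gu fv≤ f≤g =
  ≤-trans (sumFin-oneMore v f≤h (≤-trans fv≤ (s≤s (≤-reflexive (sym h-at-v)))))
          (sumFin-strict u h≤g (subst (_< g u) (sym (h-off-v u u≢v)) fu<gu))
  where
  h : Fin _ → ℕ
  h w = if ⌊ w Fin.≟ v ⌋ then g v else f w
  h-at-v : h v ≡ g v
  h-at-v = cong (λ b → if b then g v else f v) (⌊⌋-yes (v Fin.≟ v) refl)
  h-off-v : ∀ w → w ≢ v → h w ≡ f w
  h-off-v w w≢v = cong (λ b → if b then g v else f w) (⌊⌋-no (w Fin.≟ v) w≢v)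
  f≤h : ∀ w → w ≢ v → f w ≤ h w
  f≤h w w≢v = ≤-reflexive (sym (h-off-v w w≢v))
  h≤g : ∀ w → h w ≤ g w
  h≤g w with w Fin.≟ v
  ... | yes refl = ≤-refl
  ... | no w≢v with w Fin.≟ u
  ...   | yes refl = <⇒≤ fu<gu
  ...   | no w≢u   = f≤g w w≢u w≢v

shift-self : ∀ {k} (B : Array k) u → shift B u u ≗ shiftCol (B u)
shift-self B u j = cong (λ b → if b then shiftCol (B u) j else B u j) (⌊⌋-yes (u Fin.≟ u) refl)

shift-other : ∀ {k} (B : Array k) {u w} → w ≢ u → shift B u w ≗ B w
shift-other B {u} {w} w≢u j = cong (λ b → if b then shiftCol (B u) j else B w j) (⌊⌋-no (w Fin.≟ u) w≢u)

moveTok-source : ∀ {k} (B : Array k) {u v} i i' → u ≢ v → moveTok B u i v i' u ≗ removeAt i (B u)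
moveTok-source B {u} {v} i i' u≢v j =
  cong₂ (λ a b → if a ∧ ⌊ j ≟ i' ⌋ then true else if b ∧ ⌊ j ≟ i ⌋ then false else B u j)
        (⌊⌋-no (u Fin.≟ v) u≢v) (⌊⌋-yes (u Fin.≟ u) refl)

moveTok-target : ∀ {k} (B : Array k) {u v} i i' → u ≢ v → moveTok B u i v i' v ≗ insertAt i' (B v)
moveTok-target B {u} {v} i i' u≢v j =
  cong₂ (λ a b → if a ∧ ⌊ j ≟ i' ⌋ then true else if b ∧ ⌊ j ≟ i ⌋ then false else B v j)
        (⌊⌋-yes (v Fin.≟ v) refl) (⌊⌋-no (v Fin.≟ u) (u≢v ∘ sym))

moveTok-other : ∀ {k} (B : Array k) {u v w} i i' → w ≢ u → w ≢ v → moveTok B u i v i' w ≗ B w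
moveTok-other B {u} {v} {w} i i' w≢u w≢v j =
  cong₂ (λ a b → if a ∧ ⌊ j ≟ i' ⌋ then true else if b ∧ ⌊ j ≟ i ⌋ then false else B w j)
        (⌊⌋-no (w Fin.≟ v) w≢v) (⌊⌋-no (w Fin.≟ u) w≢u)

-- The target cell lies at or below the highest grounded token, so it cannot be
-- in the source column: every move is a transfer step.
move-distinct : ∀ {k} {B : Array k} {u v i i'} → HighestGrounded B u i → B v i' ≡ false → i' ≤ i → u ≢ v
move-distinct {B = B} hg Bvi' i'≤i refl with trans (sym (highestGrounded⇒full {B = B} hg _ i'≤i)) Bvi'
... | ()

record Split {n} (x y : State (suc n)) (A B : ℕ) : Set where
  constructor split
  field
    middle  : State (suc n)
    t₁ t₂   : ℕ
    first   : Run x middle t₁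
    second  : Run middle y t₂
    first≤  : t₁ ≤ A
    second≤ : t₂ ≤ B

split-run : ∀ {n} {x y : State (suc n)} {t} → Run x y t → ∀ A B → t ≤ A + B → Split x y A B
split-run (done x) A B _ = split x 0 0 (done x) (done x) z≤n z≤n
split-run (step {b = false} σ ρ) A B t≤A+B with split-run ρ A B t≤A+B
... | split μ t₁ t₂ ρ₁ ρ₂ t₁≤A t₂≤B = split μ t₁ t₂ (step σ ρ₁) ρ₂ t₁≤A t₂≤B
split-run {x = x} (step {b = true} σ ρ) zero B t≤B = split x 0 _ (done x) (step σ ρ) z≤n t≤B
split-run (step {b = true} σ ρ) (suc A) B (s≤s t≤A+B) with split-run ρ A B t≤A+B
... | split μ t₁ t₂ ρ₁ ρ₂ t₁≤A t₂≤B = split μ (suc t₁) t₂ (step σ ρ₁) ρ₂ (s≤s t₁≤A) t₂≤B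

-- Throughout, R is a row bound: all tokens of the arrays considered lie in rows
-- below R, and all counting is done below R.
module Game {n : ℕ} (R : ℕ) where

  Arr : Set
  Arr = Array (suc n)

  Bounded : Arr → Set
  Bounded B = ∀ w → EmptyFrom R (B w)

  size : Arr → Fin (suc n) → ℕ
  size B w = count (B w) R

  total : Arr → ℕ
  total B = sumFin (size B)

  sizeFrom : ℕ → Arr → Fin (suc n) → ℕ
  sizeFrom k B w = countFrom k (B w) R

  shift-bounded : ∀ {B} u → Bounded B → Bounded (shift B u)
  shift-bounded {B} u bounded w with u Fin.≟ w
  ... | yes refl = λ j R≤j → trans (shift-self B u j) (shiftCol-emptyFrom (bounded u) j R≤j)
  ... | no u≢w   = λ j R≤j → trans (shift-other B (u≢w ∘ sym) j) (bounded w j R≤j)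

  shift-size : ∀ {B} u → Bounded B → ∀ w → size (shift B u) w ≡ size B w
  shift-size {B} u bounded w with u Fin.≟ w
  ... | yes refl = trans (count-cong R (λ j _ → shift-self B u j)) (count-shiftCol-closed (B u) R (bounded u R ≤-refl))
  ... | no u≢w   = count-cong R (λ j _ → shift-other B (u≢w ∘ sym) j)

  shift-sizeFrom : ∀ {B} u → Bounded B → ∀ k w → sizeFrom k (shift B u) w ≤ sizeFrom k B w
  shift-sizeFrom {B} u bounded k w with u Fin.≟ w
  ... | yes refl = ≤-trans (≤-reflexive (countFrom-cong k R (shift-self B u)))
                           (countFrom-shiftCol k (B u) R (bounded u R ≤-refl))
  ... | no u≢w   = ≤-reflexive (countFrom-cong k R (shift-other B (u≢w ∘ sym)))

  module Transfer {B : Arr} {u v i i'} (hg : HighestGrounded B u i) (Bvi' : B v i' ≡ false) (i'≤i : i' ≤ i)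
                  (bounded : Bounded B) where

    M : Arr
    M = moveTok B u i v i'

    u≢v : u ≢ v
    u≢v = move-distinct hg Bvi' i'≤i

    i<R : i < R
    i<R = emptyFrom⇒< (bounded u) (proj₁ hg)

    source⊆ : M u ⊆ᵇ B u
    source⊆ j Mu = removeAt-⊆ i (B u) j (trans (sym (moveTok-source B i i' u≢v j)) Mu)

    moved-bounded : Bounded M
    moved-bounded w with u Fin.≟ w | v Fin.≟ w
    ... | yes refl | _        = emptyFrom-⊆ source⊆ (bounded u)
    ... | no _     | yes refl = λ j R≤j → trans (moveTok-target B i i' u≢v j)
                                           (insertAt-emptyFrom (≤-<-trans i'≤i i<R) (bounded v) j R≤j)
    ... | no u≢w   | no v≢w   = λ j R≤j → trans (moveTok-other B i i' (u≢w ∘ sym) (v≢w ∘ sym) j) (bounded w j R≤j)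

    source-size : suc (size M u) ≡ size B u
    source-size = trans (cong suc (count-cong R (λ j _ → moveTok-source B i i' u≢v j)))
                        (count-removeAt (B u) R (proj₁ hg) i<R)

    target-size : size M v ≤ suc (size B v)
    target-size = ≤-trans (≤-reflexive (count-cong R (λ j _ → moveTok-target B i i' u≢v j))) (count-insertAt i' (B v) R)

    other-size : ∀ w → w ≢ u → w ≢ v → size M w ≡ size B w
    other-size w w≢u w≢v = count-cong R (λ j _ → moveTok-other B i i' w≢u w≢v j)

    moved-size : ∀ w → size M w ≤ suc (size B w)
    moved-size w with u Fin.≟ w | v Fin.≟ w
    ... | yes refl | _        = ≤-trans (n≤1+n _) (≤-trans (≤-reflexive source-size) (n≤1+n _))
    ... | no _     | yes refl = target-size
    ... | no u≢w   | no v≢w   = ≤-trans (≤-reflexive (other-size w (u≢w ∘ sym) (v≢w ∘ sym))) (n≤1+n _)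

    moved-total : total M ≤ total B
    moved-total = sumFin-exchange u≢v (≤-reflexive source-size) target-size
                                  (λ w w≢u w≢v → ≤-reflexive (other-size w w≢u w≢v))

    source-sizeFrom : ∀ k → sizeFrom k M u ≤ sizeFrom k B u
    source-sizeFrom k = countFrom-mono k source⊆ R

    target-sizeFrom : ∀ k → sizeFrom k M v ≤ suc (sizeFrom k B v)
    target-sizeFrom k = ≤-trans (≤-reflexive (countFrom-cong k R (moveTok-target B i i' u≢v)))
                                (countFrom-insertAt k i' (B v) R)

    target-sizeFrom-low : ∀ k → i' < k → sizeFrom k M v ≤ sizeFrom k B v
    target-sizeFrom-low k i'<k = ≤-trans (≤-reflexive (countFrom-cong k R (moveTok-target B i i' u≢v)))
                                         (countFrom-insertAt-below k (B v) R i'<k)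

    other-sizeFrom : ∀ k w → w ≢ u → w ≢ v → sizeFrom k M w ≡ sizeFrom k B w
    other-sizeFrom k w w≢u w≢v = countFrom-cong k R (moveTok-other B i i' w≢u w≢v)

  step-bounded : ∀ {x y b} → Step x y b → Bounded (arr x) → Bounded (arr y)
  step-bounded (noMove B u h) bounded = shift-bounded u bounded
  step-bounded (move B u h i v i' hg Bvi' i'≤i _ _) bounded =
    shift-bounded u (Transfer.moved-bounded hg Bvi' i'≤i bounded)

  step-total : ∀ {x y b} → Step x y b → Bounded (arr x) → total (arr y) ≤ total (arr x)
  step-total (noMove B u h) bounded = sumFin-mono (≤-reflexive ∘ shift-size u bounded)
  step-total (move B u h i v i' hg Bvi' i'≤i _ _) bounded =
    ≤-trans (sumFin-mono (≤-reflexive ∘ shift-size u moved-bounded)) moved-total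
    where open Transfer hg Bvi' i'≤i bounded

  step-gain : ∀ {x y b} → Step x y b → Bounded (arr x) → ∀ w → size (arr y) w ≤ indicator b + size (arr x) w
  step-gain (noMove B u h) bounded w = ≤-reflexive (shift-size u bounded w)
  step-gain (move B u h i v i' hg Bvi' i'≤i _ _) bounded w = begin
    size (shift M u) w                         ≡⟨ shift-size u moved-bounded w ⟩
    size M w                                   ≤⟨ moved-size w ⟩
    suc (size B w)                             ≡⟨ cong (λ b → indicator (not b) + size B w) (sym (⌊⌋-no (u Fin.≟ v) u≢v)) ⟩
    indicator (not ⌊ u Fin.≟ v ⌋) + size B w   ∎
    where
    open Transfer hg Bvi' i'≤i bounded
    open ≤-Reasoning

  run-bounded : ∀ {x y t} → Run x y t → Bounded (arr x) → Bounded (arr y)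
  run-bounded (done _)   bounded = bounded
  run-bounded (step σ ρ) bounded = run-bounded ρ (step-bounded σ bounded)

  run-total : ∀ {x y t} → Run x y t → Bounded (arr x) → total (arr y) ≤ total (arr x)
  run-total (done _)   _       = ≤-refl
  run-total (step σ ρ) bounded = ≤-trans (run-total ρ (step-bounded σ bounded)) (step-total σ bounded)

  run-gain : ∀ {x y t} → Run x y t → Bounded (arr x) → ∀ w → size (arr y) w ≤ t + size (arr x) w
  run-gain (done _) _ w = ≤-refl
  run-gain (step {b = false} σ ρ) bounded w =
    ≤-trans (run-gain ρ (step-bounded σ bounded) w) (+-monoʳ-≤ _ (step-gain σ bounded w))
  run-gain (step {b = true} {t = t} σ ρ) bounded w =
    ≤-trans (run-gain ρ (step-bounded σ bounded) w)
            (≤-trans (+-monoʳ-≤ t (step-gain σ bounded w)) (≤-reflexive (+-suc t _)))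

  History : Set
  History = List (Fin (suc n) × Fin (suc n))

  open import Data.List.Membership.DecPropositional (≡-dec (Fin._≟_ {suc n}) (Fin._≟_ {suc n})) using (_∈?_)

  -- The potential of a history, relative to a snapshot S of the array, a target
  -- column and a size threshold c: the number of columns w that held at least
  -- c tokens in S and have not yet transferred a token to the target.
  module Potential (S : Arr) (target : Fin (suc n)) (c : ℕ) where

    unused : History → Fin (suc n) → Bool
    unused h w = not ⌊ (w , target) ∈? h ⌋ ∧ ⌊ c ≤? size S w ⌋

    potential : History → ℕ
    potential h = sumFin (indicator ∘ unused h)

    unused-elim : ∀ {h w} → unused h w ≡ true → ((w , target) ∉ h) × (c ≤ size S w)
    unused-elim {h} {w} e =
      ⌊⌋-false ((w , target) ∈? h) (not-true (∧-conicalˡ _ _ e)) ,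
      ⌊⌋-true (c ≤? size S w) (∧-conicalʳ _ _ e)
      where
      not-true : ∀ {b} → not b ≡ true → b ≡ false
      not-true {false} _ = refl

    unused-intro : ∀ {h w} → (w , target) ∉ h → c ≤ size S w → unused h w ≡ true
    unused-intro {h} {w} w∉h c≤size =
      cong₂ (λ a b → not a ∧ b) (⌊⌋-no ((w , target) ∈? h) w∉h) (⌊⌋-yes (c ≤? size S w) c≤size)

    unused-used : ∀ {h w} → (w , target) ∈ h → unused h w ≡ false
    unused-used {h} {w} w∈h = cong (λ a → not a ∧ ⌊ c ≤? size S w ⌋) (⌊⌋-yes ((w , target) ∈? h) w∈h)

    unused-cons : ∀ p h w → unused (p ∷ h) w ≡ true → unused h w ≡ true
    unused-cons p h w e = let w∉p∷h , c≤size = unused-elim e in unused-intro (w∉p∷h ∘ there) c≤size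

    -- Histories only grow, so the potential never increases ...
    potential-cons : ∀ p h → potential (p ∷ h) ≤ potential h
    potential-cons p h = sumFin-mono (λ w → indicator-mono (unused-cons p h w))

    potential-use : ∀ {h u} → (u , target) ∉ h → c ≤ size S u → suc (potential ((u , target) ∷ h)) ≤ potential h
    potential-use {h} {u} u∉h c≤size =
      sumFin-strict u (λ w → indicator-mono (unused-cons (u , target) h w))
        (subst₂ (λ a b → suc (indicator a) ≤ indicator b) (sym (unused-used (here refl))) (sym (unused-intro u∉h c≤size)) ≤-refl)

    -- Every counted column holds at least c of the tokens of S.
    potential-bound : ∀ h → potential h * c ≤ total S
    potential-bound h = begin
      potential h * c                           ≡⟨ sym (sumFin-*ʳ (indicator ∘ unused h) c) ⟩
      sumFin (λ w → indicator (unused h w) * c) ≤⟨ sumFin-mono heavy ⟩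
      total S                                   ∎
      where
      open ≤-Reasoning
      heavy : ∀ w → indicator (unused h w) * c ≤ size S w
      heavy w with unused h w in e
      ... | false = z≤n
      ... | true  = ≤-trans (≤-reflexive (+-identityʳ c)) (proj₂ (unused-elim e))

    -- A raise needs a transfer from a cell at height
    -- ≥ k, whose source column then has more than k tokens; if no column exceeds
    -- its size in S by more than K and k + 1 = c + K, the source held at least c
    -- tokens in S, and its pair with the target is used up.
    potential-step : ∀ {k K} → suc k ≡ c + K → ∀ {x y b} → Step x y b → Bounded (arr x) →
                     (∀ w → size (arr x) w ≤ size S w + K) →
                     sizeFrom k (arr y) target + potential (hist y) ≤ sizeFrom k (arr x) target + potential (hist x)
    potential-step {k} _ (noMove B u h) bounded _ = +-monoˡ-≤ (potential h) (shift-sizeFrom u bounded k target)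
    potential-step {k} {K} k+1≡c+K (move B u h i v i' hg Bvi' i'≤i uv∉h _) bounded within =
      ≤-trans (+-monoˡ-≤ _ (shift-sizeFrom u moved-bounded k target)) moved
      where
      open Transfer hg Bvi' i'≤i bounded

      heavy-source : k ≤ i' → c ≤ size S u
      heavy-source k≤i' = +-cancelʳ-≤ K c (size S u) (begin
        c + K         ≡⟨ sym k+1≡c+K ⟩
        suc k         ≤⟨ s≤s (≤-trans k≤i' i'≤i) ⟩
        suc i         ≤⟨ highestGrounded-count {B = B} hg i<R ⟩
        size B u      ≤⟨ within u ⟩
        size S u + K  ∎)
        where open ≤-Reasoning

      moved : sizeFrom k M target + potential ((u , v) ∷ h) ≤ sizeFrom k B target + potential h
      moved with u Fin.≟ target | v Fin.≟ target
      ... | yes refl | _        = +-mono-≤ (source-sizeFrom k) (potential-cons _ h)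
      ... | no u≢t   | no v≢t   = +-mono-≤ (≤-reflexive (other-sizeFrom k target (u≢t ∘ sym) (v≢t ∘ sym))) (potential-cons _ h)
      ... | no _     | yes refl with i' <? k
      ...   | yes i'<k = +-mono-≤ (target-sizeFrom-low k i'<k) (potential-cons _ h)
      ...   | no i'≮k  = begin
        sizeFrom k M v + potential ((u , v) ∷ h)        ≤⟨ +-monoˡ-≤ _ (target-sizeFrom k) ⟩
        suc (sizeFrom k B v) + potential ((u , v) ∷ h)  ≡⟨ sym (+-suc _ _) ⟩
        sizeFrom k B v + suc (potential ((u , v) ∷ h))  ≤⟨ +-monoʳ-≤ _ (potential-use uv∉h (heavy-source (≮⇒≥ i'≮k))) ⟩
        sizeFrom k B v + potential h                    ∎
        where open ≤-Reasoning

    segment : ∀ {k K} → suc k ≡ c + K → ∀ {d x y t} →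
              (∀ {z t'} → Run x z t' → t' ≤ d → ∀ w → size (arr z) w ≤ size S w + K) →
              Run x y t → t ≤ d → Bounded (arr x) →
              sizeFrom k (arr y) target ≤ sizeFrom k (arr x) target + potential (hist x)
    segment _ _ (done _) _ _ = m≤m+n _ _
    segment k+1≡c+K {x = x} within (step {b = false} σ ρ) t≤d bounded =
      ≤-trans (segment k+1≡c+K (λ ρ' t'≤d → within (step σ ρ') t'≤d) ρ t≤d (step-bounded σ bounded))
              (potential-step k+1≡c+K σ bounded (within (done x) z≤n))
    segment k+1≡c+K {x = x} within (step {b = true} σ ρ) (s≤s t≤d) bounded =
      ≤-trans (segment k+1≡c+K (λ ρ' t'≤d → within (step σ ρ') (s≤s t'≤d)) ρ t≤d (step-bounded σ bounded))
              (potential-step k+1≡c+K σ bounded (within (done x) z≤n))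

  GainBound : ℕ → ℕ → ℕ → Set
  GainBound m d K = ∀ {x y t} → Run x y t → t ≤ d → Bounded (arr x) → total (arr x) ≤ m →
                    ∀ w → size (arr y) w ≤ size (arr x) w + K

  gain-weaken : ∀ {m d d' K K'} → d' ≤ d → K ≤ K' → GainBound m d K → GainBound m d' K'
  gain-weaken d'≤d K≤K' gain ρ t≤d' bounded total≤m w =
    ≤-trans (gain ρ (≤-trans t≤d' d'≤d) bounded total≤m w) (+-monoʳ-≤ _ K≤K')

  gain-single : ∀ {m} → GainBound m 1 1
  gain-single ρ t≤1 bounded _ w =
    ≤-trans (run-gain ρ bounded w) (≤-trans (+-monoˡ-≤ _ t≤1) (≤-reflexive (+-comm 1 _)))

  gain-empty : ∀ {m d K} → m ≡ 0 → GainBound m d K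
  gain-empty refl {y = y} ρ _ bounded total≤0 w = begin
    size (arr y) w       ≤⟨ sumFin-term (size (arr y)) w ⟩
    total (arr y)        ≤⟨ run-total ρ bounded ⟩
    _                    ≤⟨ total≤0 ⟩
    0                    ≤⟨ z≤n ⟩
    _                    ∎
    where open ≤-Reasoning

  -- Cut a run with at most d + d transfer steps into two
  -- halves with at most d each, and let k = c + K.  Below height k a column
  -- holds at most k tokens; by the segment lemma, at height ≥ k each half adds
  -- at most its initial potential, and the two potentials together are at most
  -- 2m / c ≤ c.
  gain-double : ∀ {m c} .{{_ : NonZero c}} → 2 * m ≤ c * c → ∀ {d K} →
                GainBound m d (suc K) → GainBound m (d + d) (c + K + c)
  gain-double {m} {c} 2m≤c² {d} {K} gain {x} {y} ρ t≤d+d bounded total≤m w = begin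
    size (arr y) w                                   ≤⟨ count≤threshold+countFrom k (arr y w) R ⟩
    k + sizeFrom k (arr y) w                         ≤⟨ +-monoʳ-≤ k second-half ⟩
    k + (sizeFrom k (arr middle) w + p₂)             ≤⟨ +-monoʳ-≤ k (+-monoˡ-≤ p₂ first-half) ⟩
    k + (sizeFrom k (arr x) w + p₁ + p₂)             ≤⟨ +-monoʳ-≤ k (+-monoˡ-≤ p₂ (+-monoˡ-≤ p₁ (countFrom≤count k (arr x w) R))) ⟩
    k + (size (arr x) w + p₁ + p₂)                   ≡⟨ cong (k +_) (+-assoc (size (arr x) w) p₁ p₂) ⟩
    k + (size (arr x) w + (p₁ + p₂))                 ≤⟨ +-monoʳ-≤ k (+-monoʳ-≤ (size (arr x) w) p₁+p₂≤c) ⟩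
    k + (size (arr x) w + c)                         ≡⟨ x∙yz≈y∙xz k (size (arr x) w) c ⟩
    size (arr x) w + (k + c)                         ∎
    where
    open ≤-Reasoning
    open Split (split-run ρ d d t≤d+d)
    k : ℕ
    k = c + K
    k+1≡c+K+1 : suc k ≡ c + suc K
    k+1≡c+K+1 = sym (+-suc c K)
    bounded-middle : Bounded (arr middle)
    bounded-middle = run-bounded first bounded
    total-middle≤m : total (arr middle) ≤ m
    total-middle≤m = ≤-trans (run-total first bounded) total≤m
    module P₁ = Potential (arr x) w c
    module P₂ = Potential (arr middle) w c
    p₁ p₂ : ℕ
    p₁ = P₁.potential (hist x)
    p₂ = P₂.potential (hist middle)
    first-half : sizeFrom k (arr middle) w ≤ sizeFrom k (arr x) w + p₁
    first-half = P₁.segment k+1≡c+K+1 (λ ρ' t'≤d → gain ρ' t'≤d bounded total≤m) first first≤ bounded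
    second-half : sizeFrom k (arr y) w ≤ sizeFrom k (arr middle) w + p₂
    second-half = P₂.segment k+1≡c+K+1 (λ ρ' t'≤d → gain ρ' t'≤d bounded-middle total-middle≤m)
                             second second≤ bounded-middle
    p₁+p₂≤c : p₁ + p₂ ≤ c
    p₁+p₂≤c = *-cancelʳ-≤ (p₁ + p₂) c c (begin
      (p₁ + p₂) * c  ≡⟨ *-distribʳ-+ c p₁ p₂ ⟩
      p₁ * c + p₂ * c ≤⟨ +-mono-≤ (≤-trans (P₁.potential-bound (hist x)) total≤m)
                                 (≤-trans (P₂.potential-bound (hist middle)) total-middle≤m) ⟩
      m + m          ≡⟨ cong (m +_) (sym (+-identityʳ m)) ⟩
      2 * m          ≤⟨ 2m≤c² ⟩
      c * c          ∎)

  gain-bound : ∀ {m c} → 2 * m ≤ c * c → ∀ ℓ → GainBound m (2 ^ ℓ) (1 + 2 * ℓ * c)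
  gain-bound _ zero = gain-single
  gain-bound {m} {zero} 2m≤0 (suc ℓ) = gain-empty (m+n≡0⇒m≡0 m (n≤0⇒n≡0 2m≤0))
  gain-bound {m} {c@(suc _)} 2m≤c² (suc ℓ) =
    gain-weaken (≤-reflexive (cong (2 ^ ℓ +_) (+-identityʳ (2 ^ ℓ))))
                (≤-trans (≤-reflexive (doubled ℓ c)) (n≤1+n _))
                (gain-double 2m≤c² (gain-bound 2m≤c² ℓ))
    where
    doubled : ∀ ℓ c → c + 2 * ℓ * c + c ≡ 2 * suc ℓ * c
    doubled = solve-∀

removeCell : ∀ {k} → Fin k → ℕ → Array k → Array k
removeCell u i B w = if ⌊ w Fin.≟ u ⌋ then removeAt i (B w) else B w

∈-tail : ∀ {A : Set} {x y : A} {ys} → x ∈ y ∷ ys → x ≢ y → x ∈ ys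
∈-tail (here x≡y) x≢y = contradiction x≡y x≢y
∈-tail (there x∈ys) _ = x∈ys

tokens≤length : ∀ {k} (cs : List (Fin k × ℕ)) (B : Array k) N → (∀ w j → B w j ≡ true → (w , j) ∈ cs) →
                sumFin (λ w → count (B w) N) ≤ length cs
tokens≤length {k} [] B N B⊆[] = begin
  sumFin (λ w → count (B w) N) ≤⟨ sumFin-mono (λ w → ≤-trans (count-mono (nothing w) N) (≤-reflexive (count-nothing N))) ⟩
  sumFin {k} (λ _ → 0)          ≡⟨ sumFin-zero k ⟩
  0                             ∎
  where
  open ≤-Reasoning
  nothing : ∀ w → B w ⊆ᵇ (λ _ → false)
  nothing w j Bwj = contradiction (B⊆[] w j Bwj) λ ()
tokens≤length ((u , i) ∷ cs) B N B⊆ = begin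
  sumFin (λ w → count (B w) N)                        ≤⟨ sumFin-oneMore u same-elsewhere one-more-at-u ⟩
  suc (sumFin (λ w → count (removeCell u i B w) N))   ≤⟨ s≤s (tokens≤length cs (removeCell u i B) N rest) ⟩
  suc (length cs)                                     ∎
  where
  open ≤-Reasoning
  same-elsewhere : ∀ w → w ≢ u → count (B w) N ≤ count (removeCell u i B w) N
  same-elsewhere w w≢u = ≤-reflexive (cong (λ b → count (if b then removeAt i (B w) else B w) N)
                                           (sym (⌊⌋-no (w Fin.≟ u) w≢u)))
  one-more-at-u : count (B u) N ≤ suc (count (removeCell u i B u) N)
  one-more-at-u = ≤-trans (count≤removeAt (B u) i N)
                          (≤-reflexive (cong (λ b → suc (count (if b then removeAt i (B u) else B u) N))
                                             (sym (⌊⌋-yes (u Fin.≟ u) refl))))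
  rest : ∀ w j → removeCell u i B w j ≡ true → (w , j) ∈ cs
  rest w j with w Fin.≟ u
  ... | no w≢u = λ Bwj → ∈-tail (B⊆ w j Bwj) (w≢u ∘ cong proj₁)
  ... | yes refl with j ≟ i
  ...   | yes _   = λ ()
  ...   | no j≢i  = λ Bwj → ∈-tail (B⊆ w j Bwj) (j≢i ∘ cong proj₂)

count≤length : ∀ (rs : List ℕ) f N → (∀ j → f j ≡ true → j ∈ rs) → count f N ≤ length rs
count≤length rs f N f⊆rs = begin
  count f N                     ≡⟨ sym (+-identityʳ _) ⟩
  sumFin {1} (λ _ → count f N)  ≤⟨ tokens≤length (map tag rs) (λ _ → f) N (λ { fzero j fj → ∈-map⁺ tag (f⊆rs j fj) }) ⟩
  length (map tag rs)           ≡⟨ length-map tag rs ⟩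
  length rs                     ∎
  where
  open ≤-Reasoning
  tag : ℕ → Fin 1 × ℕ
  tag j = fzero , j

length≤count : ∀ {rs : List ℕ} {f} N → Unique rs → (∀ j → j ∈ rs → f j ≡ true) → (∀ j → j ∈ rs → j < N) →
               length rs ≤ count f N
length≤count {[]}     N _ _ _ = z≤n
length≤count {x ∷ xs} {f} N (x∉xs ∷ unique) rs⊆f rs<N = begin
  suc (length xs)              ≤⟨ s≤s (length≤count N unique xs⊆ (λ j j∈xs → rs<N j (there j∈xs))) ⟩
  suc (count (removeAt x f) N) ≡⟨ count-removeAt f N (rs⊆f x (here refl)) (rs<N x (here refl)) ⟩
  count f N                    ∎
  where
  open ≤-Reasoning
  xs⊆ : ∀ j → j ∈ xs → removeAt x f j ≡ true
  xs⊆ j j∈xs = trans (removeAt-there f (λ j≡x → All-lookup x∉xs j∈xs (sym j≡x))) (rs⊆f j (there j∈xs))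

maxRow : ∀ {k} → List (Fin k × ℕ) → ℕ
maxRow cs = Extrema.max 0 (map proj₂ cs)

row≤maxRow : ∀ {k} {cs : List (Fin k × ℕ)} {w j} → (w , j) ∈ cs → j ≤ maxRow cs
row≤maxRow {cs = cs} w,j∈cs = All-lookup (Extrema.xs≤max 0 (map proj₂ cs)) (∈-map⁺ proj₂ w,j∈cs)

-- Lemma 3.5.  All tokens lie below R = 1 + (highest occupied row), so the
-- column sizes a and b are the counts below R, and gain-bound applies.
lemma3p5 : (ℓ m n : ℕ) (s₀ s₁ : State (suc n)) (t : ℕ) →
           Run s₀ s₁ t → hist s₀ ≡ [] → TokenCount (arr s₀) m → t ≤ 2 ^ ℓ →
           (c : ℕ) → IsCeilSqrt (2 * m) c →
           (u : Fin (suc n)) (a b : ℕ) →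
           ColCount (arr s₀) u a → ColCount (arr s₁) u b →
           b ≤ a + (1 + 2 * ℓ * c)
lemma3p5 ℓ m n s₀ s₁ t run _ (cs , |cs|≡m , _ , cs-exact) t≤2^ℓ c (2m≤c² , _) u a b
         (rs₀ , |rs₀|≡a , _ , rs₀-exact) (rs₁ , |rs₁|≡b , rs₁-unique , rs₁-exact) = begin
  b                                   ≡⟨ sym |rs₁|≡b ⟩
  length rs₁                          ≤⟨ length≤count R rs₁-unique rs₁⊆ (λ j → emptyFrom⇒< (bounded₁ u) ∘ rs₁⊆ j) ⟩
  size (arr s₁) u                     ≤⟨ gain-bound 2m≤c² ℓ run t≤2^ℓ bounded₀ total≤m u ⟩
  size (arr s₀) u + (1 + 2 * ℓ * c)   ≤⟨ +-monoˡ-≤ _ (count≤length rs₀ (arr s₀ u) R (proj₁ ∘ rs₀-exact)) ⟩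
  length rs₀ + (1 + 2 * ℓ * c)        ≡⟨ cong (_+ (1 + 2 * ℓ * c)) |rs₀|≡a ⟩
  a + (1 + 2 * ℓ * c)                 ∎
  where
  open ≤-Reasoning
  R : ℕ
  R = suc (maxRow cs)
  open Game {n} R
  bounded₀ : Bounded (arr s₀)
  bounded₀ w = emptyFrom-intro (λ j Bwj → s≤s (row≤maxRow (proj₁ (cs-exact w j) Bwj)))
  bounded₁ : Bounded (arr s₁)
  bounded₁ = run-bounded run bounded₀
  total≤m : total (arr s₀) ≤ m
  total≤m = ≤-trans (tokens≤length cs (arr s₀) R (λ w j → proj₁ (cs-exact w j))) (≤-reflexive |cs|≡m)
  rs₁⊆ : ∀ j → j ∈ rs₁ → arr s₁ u j ≡ true
  rs₁⊆ j = proj₂ (rs₁-exact j)
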